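{- Let $K$ be a cubic field with fundamental discriminant, with associated binary cubic form $F_K=(a,b,c,d)$, let $\theta$ be a root of $F_K(x,1)$, $\alpha=-a\theta$, $\beta=d/\theta$, $\alpha_0=\alpha-\frac{\mathrm{tr}_{K/\mathbb{Q}}(\alpha)}{3}$, $\beta_0=\beta-\frac{\mathrm{tr}_{K/\mathbb{Q}}(\beta)}{3}$. Then $$O_K^0=\begin{cases}\mathrm{Span}_{\mathbb{Z}}\{\alpha_0,3\beta_0\}&\text{if } b\equiv0\pmod3,\\ \mathrm{Span}_{\mathbb{Z}}\{3\alpha_0,\beta_0\}&\text{if } c\equiv0\pmod3,\\ \mathrm{Span}_{\mathbb{Z}}\{\alpha_0-\beta_0,3\beta_0\}&\text{if } b\equiv-c\pmod3,\\ \mathrm{Span}_{\mathbb{Z}}\{\alpha_0+\beta_0,3\beta_0\}&\text{if } b\equiv c\pmod3.\end{cases}$$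
   Context: A fundamental discriminant is the discriminant of a quadratic field. $O_K^0=\{x\in O_K:\mathrm{tr}_{K/\mathbb{Q}}(x)=0\}$. $(a,b,c,d)$ denotes $ax^3+bx^2y+cxy^2+dy^3$. By Delone–Faddeev, $K$ has an associated integral binary cubic form $F_K=(a,b,c,d)$, unique up to $\mathrm{GL}_2(\mathbb{Z})$-equivalence, of discriminant $d_K$, such that for a root $\theta$ of $F_K(x,1)$ one has $K=\mathbb{Q}(\theta)$ and $\{1,-a\theta,d/\theta\}$ is a $\mathbb{Z}$-basis of $O_K$. -}

module Defs where

open import Data.Nat as ℕ using (ℕ; zero; suc)
open import Data.Integer as ℤ using (ℤ; +_; -[1+_])
open import Data.Integer.Divisibility using (_∣_)
open import Data.Rational as ℚ using (ℚ; 0ℚ; 1ℚ)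
open import Data.List using (List; []; _∷_)
open import Data.Product using (Σ; ∃; _×_; _,_)
open import Data.Sum using (_⊎_)
open import Relation.Binary.PropositionalEquality using (_≡_; _≢_)
open import Relation.Nullary using (¬_)

ι : ℤ → ℚ
ι n = n ℚ./ 1

-- total inverse of an integer in ℚ (convention 1/0 = 0; only ever used
-- for a ≠ 0, which follows from irreducibility of F)
invℤ : ℤ → ℚ
invℤ (+ zero)  = 0ℚ
invℤ (+ suc n) = (+ 1) ℚ./ suc n
invℤ -[1+ n ]  = -[1+ 0 ] ℚ./ suc n

SquareFree : ℤ → Set
SquareFree D = ∀ (n : ℤ) → (n ℤ.* n) ∣ D → ℤ.∣ n ∣ ≡ 1

IsFundamental : ℤ → Set
IsFundamental D =
  (D ≢ + 1)
  × ( ((+ 4) ∣ (D ℤ.- + 1) × SquareFree D)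
    ⊎ (Σ ℤ λ m → D ≡ (+ 4) ℤ.* m
         × ((+ 4) ∣ (m ℤ.- + 2) ⊎ (+ 4) ∣ (m ℤ.- + 3))
         × SquareFree m))

-- Binary cubic form F = (a,b,c,d) = a x^3 + b x^2 y + c x y^2 + d y^3

disc : ℤ → ℤ → ℤ → ℤ → ℤ
disc a b c d =
  b ℤ.* b ℤ.* c ℤ.* c ℤ.- (+ 4) ℤ.* a ℤ.* c ℤ.* c ℤ.* c
  ℤ.- (+ 4) ℤ.* b ℤ.* b ℤ.* b ℤ.* d ℤ.- (+ 27) ℤ.* a ℤ.* a ℤ.* d ℤ.* d
  ℤ.+ (+ 18) ℤ.* a ℤ.* b ℤ.* c ℤ.* d

IrreducibleForm : ℤ → ℤ → ℤ → ℤ → Set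
IrreducibleForm a b c d =
  ¬ (Σ ℚ λ p → Σ ℚ λ q → Σ ℚ λ r → Σ ℚ λ s → Σ ℚ λ t →
       (ι a ≡ p ℚ.* r) × (ι b ≡ p ℚ.* s ℚ.+ q ℚ.* r)
     × (ι c ≡ p ℚ.* t ℚ.+ q ℚ.* s) × (ι d ≡ q ℚ.* t))

-- The cubic field K = ℚ(θ) = ℚ[X]/(F(X,1)), with F(X,1) = aX^3+bX^2+cX+d.
-- An element x0 + x1 θ + x2 θ² is represented by its coordinates in the
-- power basis (1, θ, θ²).

record K : Set where
  constructor ⟨_,_,_⟩
  field
    c0 c1 c2 : ℚ

open K public

module Field (a b c d : ℤ) where

  -- θ³ = r0 + r1 θ + r2 θ²   (from aθ³ + bθ² + cθ + d = 0)
  r0 r1 r2 : ℚ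
  r0 = ℚ.- (ι d ℚ.* invℤ a)
  r1 = ℚ.- (ι c ℚ.* invℤ a)
  r2 = ℚ.- (ι b ℚ.* invℤ a)

  infixl 6 _⊕_ _⊖_
  infixl 7 _⊛_ _·_

  _⊕_ : K → K → K
  ⟨ x0 , x1 , x2 ⟩ ⊕ ⟨ y0 , y1 , y2 ⟩ = ⟨ x0 ℚ.+ y0 , x1 ℚ.+ y1 , x2 ℚ.+ y2 ⟩

  _·_ : ℚ → K → K
  q · ⟨ x0 , x1 , x2 ⟩ = ⟨ q ℚ.* x0 , q ℚ.* x1 , q ℚ.* x2 ⟩

  _⊖_ : K → K → K
  x ⊖ y = x ⊕ (ℚ.- 1ℚ) · y

  [_] : ℚ → K
  [ q ] = ⟨ q , 0ℚ , 0ℚ ⟩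

  𝟘 𝟙 θ : K
  𝟘 = [ 0ℚ ]
  𝟙 = [ 1ℚ ]
  θ = ⟨ 0ℚ , 1ℚ , 0ℚ ⟩

  -- multiplication: multiply polynomials, reduce with θ³ = r0 + r1θ + r2θ²
  -- and θ⁴ = r2 r0 + (r0 + r2 r1) θ + (r1 + r2 r2) θ²
  _⊛_ : K → K → K
  ⟨ x0 , x1 , x2 ⟩ ⊛ ⟨ y0 , y1 , y2 ⟩ =
    let p0 = x0 ℚ.* y0
        p1 = x0 ℚ.* y1 ℚ.+ x1 ℚ.* y0
        p2 = x0 ℚ.* y2 ℚ.+ x1 ℚ.* y1 ℚ.+ x2 ℚ.* y0
        p3 = x1 ℚ.* y2 ℚ.+ x2 ℚ.* y1
        p4 = x2 ℚ.* y2
    in ⟨ p0 ℚ.+ p3 ℚ.* r0 ℚ.+ p4 ℚ.* (r2 ℚ.* r0)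
       , p1 ℚ.+ p3 ℚ.* r1 ℚ.+ p4 ℚ.* (r0 ℚ.+ r2 ℚ.* r1)
       , p2 ℚ.+ p3 ℚ.* r2 ℚ.+ p4 ℚ.* (r1 ℚ.+ r2 ℚ.* r2) ⟩

  -- trace tr_{K/ℚ}: trace of the ℚ-linear map y ↦ x y in the basis (1, θ, θ²)
  tr : K → ℚ
  tr x = c0 (x ⊛ 𝟙) ℚ.+ c1 (x ⊛ θ) ℚ.+ c2 (x ⊛ (θ ⊛ θ))

  -- x is an algebraic integer: it is a root of a monic polynomial with
  -- integer coefficients X^n + k_{n-1} X^{n-1} + ... + k_0, the list being
  -- [k_{n-1}, ..., k_0] (evaluated by Horner's rule)
  horner : K → K → List ℤ → K
  horner x acc []       = acc
  horner x acc (k ∷ ks) = horner x (acc ⊛ x ⊕ [ ι k ]) ks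

  IsAlgInt : K → Set
  IsAlgInt x = Σ (List ℤ) λ ks → horner x 𝟙 ks ≡ 𝟘

  InOK0 : K → Set
  InOK0 x = IsAlgInt x × tr x ≡ 0ℚ

  α : K
  α = ι (ℤ.- a) · θ

  -- β = d/θ  =  -(aθ² + bθ + c)   (since aθ³ + bθ² + cθ + d = 0)
  β : K
  β = ⟨ ι (ℤ.- c) , ι (ℤ.- b) , ι (ℤ.- a) ⟩

  third : ℚ
  third = (+ 1) ℚ./ 3

  α₀ β₀ : K
  α₀ = α ⊖ [ tr α ℚ.* third ]
  β₀ = β ⊖ [ tr β ℚ.* third ]

  SpanZ : K → K → K → Set
  SpanZ u v x = Σ ℤ λ m → Σ ℤ λ n → x ≡ ι m · u ⊕ ι n · v

  -- O_K = ℤ-span of {1, α, β} (Delone–Faddeev: it is a ℤ-basis of O_K;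
  -- linear independence over ℤ is automatic in this model)
  DeloneFaddeevBasis : Set
  DeloneFaddeevBasis =
    ∀ (x : K) →
      (IsAlgInt x → Σ ℤ λ l → Σ ℤ λ m → Σ ℤ λ n → x ≡ ι l · 𝟙 ⊕ ι m · α ⊕ ι n · β)
    × ((Σ ℤ λ l → Σ ℤ λ m → Σ ℤ λ n → x ≡ ι l · 𝟙 ⊕ ι m · α ⊕ ι n · β) → IsAlgInt x)

module Submission where

-- Writing x = l + m α + n β in the Delone–Faddeev basis, one has tr 1 = 3, tr α = b and
-- tr β = -c, so x has trace zero iff 3 l + m b - n c = 0, and then x = m α₀ + n β₀.
-- Hence O_K^0 = { m α₀ + n β₀ : 3 ∣ m b - n c }. As 9 never divides a fundamental
-- discriminant, 3 does not divide both b and c, and in each of the four cases the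
-- congruence m b ≡ n c (mod 3) becomes a single linear condition on (m , n) whose
-- solutions form the lattice spanned by the coordinates of the stated generators.

open import Defs
open import Data.Nat.Base as ℕ using (suc)
import Data.Nat.Tactic.RingSolver as ℕ-Ring
open import Data.Nat.Divisibility using () renaming (_∣_ to _∣ℕ_)
open import Data.Nat.Primality using (prime?; euclidsLemma)
open import Data.Integer as ℤ using (ℤ; +_; -[1+_])
import Data.Integer.Properties as ℤP
import Data.Integer.Tactic.RingSolver as ℤ-Ring
import Data.Integer.Divisibility.Signed as Signed
open import Data.Rational as ℚ using (ℚ; 0ℚ; 1ℚ; fromℚᵘ)
import Data.Rational.Properties as ℚP
open import Data.Rational.Unnormalised as ℚᵘ using (mkℚᵘ; *≡*)
import Data.Rational.Unnormalised.Properties as ℚᵘP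
open import Data.Empty using (⊥)
open import Data.Product using (∃; ∃₂; _×_; _,_; proj₁; proj₂)
open import Data.Sum as Sum using (_⊎_; inj₁; inj₂)
open import Function.Bundles using (_⇔_; mk⇔; Equivalence)
open import Function.Construct.Composition using (_⇔-∘_)
open import Relation.Binary.PropositionalEquality hiding ([_])
open import Relation.Nullary using (¬_; contradiction)
open import Relation.Nullary.Decidable using (from-yes; dec⇒maybe)
open import Tactic.RingSolver using (solve-∀)
open import Tactic.RingSolver.Core.AlmostCommutativeRing using (AlmostCommutativeRing; fromCommutativeRing)
open ≡-Reasoning

-- Divisibility by 3

module _ where
  open import Data.Integer using (_+_; _-_; _*_; -_)
  open Signed

  3∣*⇒3∣⊎3∣ : ∀ x y → + 3 ∣ x * y → + 3 ∣ x ⊎ + 3 ∣ y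
  3∣*⇒3∣⊎3∣ x y 3∣xy = Sum.map ∣ᵤ⇒∣ ∣ᵤ⇒∣
    (euclidsLemma ℤ.∣ x ∣ ℤ.∣ y ∣ (from-yes (prime? 3)) (subst (3 ∣ℕ_) (ℤP.abs-* x y) (∣⇒∣ᵤ 3∣xy)))

  3∣-criterion : ∀ {z k w t} → ¬ + 3 ∣ w → + 3 ∣ t → z ≡ k * w + t → (+ 3 ∣ z ⇔ + 3 ∣ k)
  3∣-criterion {k = k} {w} {t} 3∤w 3∣t refl = mk⇔ to from
    where
    to : + 3 ∣ k * w + t → + 3 ∣ k
    to 3∣z with 3∣*⇒3∣⊎3∣ k w (∣m+n∣n⇒∣m 3∣z 3∣t)
    ... | inj₁ 3∣k = 3∣k
    ... | inj₂ 3∣w = contradiction 3∣w 3∤w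
    from : + 3 ∣ k → + 3 ∣ k * w + t
    from 3∣k = ∣m∣n⇒∣m+n (∣m⇒∣m*n w 3∣k) 3∣t

  3∣⇔cancellable : ∀ w → + 3 ∣ w ⇔ ∃ λ l → l * + 3 + w ≡ + 0
  3∣⇔cancellable w = mk⇔
    (λ { (divides k refl) → - k , cancel k })
    (λ { (l , e) → divides (- l) (trans (isolate l w)
           (trans (cong (_- l * + 3) e) (trans (ℤP.+-identityˡ _) (ℤP.neg-distribˡ-* l (+ 3))))) })
    where
    cancel : ∀ k → - k * + 3 + k * + 3 ≡ + 0
    cancel = ℤ-Ring.solve-∀
    isolate : ∀ l w → w ≡ l * + 3 + w - l * + 3
    isolate = ℤ-Ring.solve-∀

  9∤fundamental : ∀ {D} → IsFundamental D → ¬ + 9 ∣ D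
  9∤fundamental (_ , inj₁ (_ , squarefree)) 9∣D with squarefree (+ 3) (∣⇒∣ᵤ 9∣D)
  ... | ()
  9∤fundamental (_ , inj₂ (m , refl , _ , squarefree)) 9∣4m with squarefree (+ 3) (∣⇒∣ᵤ 9∣m)
    where
    recover : ∀ m → + 7 * (+ 4 * m) - + 27 * m ≡ m
    recover = ℤ-Ring.solve-∀
    9∣m : + 9 ∣ m
    9∣m = subst (+ 9 ∣_) (recover m)
      (∣m∣n⇒∣m-n (∣n⇒∣m*n (+ 7) 9∣4m) (∣m⇒∣m*n m (divides (+ 3) refl)))
  ... | ()

  ¬3∣b×3∣c : ∀ a b c d → IsFundamental (disc a b c d) → + 3 ∣ b → + 3 ∣ c → ⊥
  ¬3∣b×3∣c a _ _ d F (divides b′ refl) (divides c′ refl) =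
    9∤fundamental F (divides (disc/9 a b′ c′ d) (expand a b′ c′ d))
    where
    disc/9 : ℤ → ℤ → ℤ → ℤ → ℤ
    disc/9 a b′ c′ d = + 9 * b′ * b′ * c′ * c′ - + 12 * a * c′ * c′ * c′ - + 12 * b′ * b′ * b′ * d
                       - + 3 * a * a * d * d + + 18 * a * b′ * c′ * d
    expand : ∀ a b′ c′ d → let b = b′ * + 3; c = c′ * + 3 in
      b * b * c * c - + 4 * a * c * c * c - + 4 * b * b * b * d - + 27 * a * a * d * d
      + + 18 * a * b * c * d
        ≡ (+ 9 * b′ * b′ * c′ * c′ - + 12 * a * c′ * c′ * c′ - + 12 * b′ * b′ * b′ * d
           - + 3 * a * a * d * d + + 18 * a * b′ * c′ * d) * + 9
    expand = ℤ-Ring.solve-∀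

  module _ (a b c d : ℤ) (F : IsFundamental (disc a b c d)) where

    lattice-when-3∣b : + 3 ∣ b → ∀ m n → + 3 ∣ m * b - n * c ⇔ ∃₂ λ p q → m ≡ p × n ≡ q * + 3
    lattice-when-3∣b 3∣b m n =
      span ⇔-∘ 3∣-criterion (¬3∣b×3∣c a b c d F 3∣b) (∣n⇒∣m*n m 3∣b) (regroup m n b c)
      where
      regroup : ∀ m n b c → m * b - n * c ≡ - n * c + m * b
      regroup = ℤ-Ring.solve-∀
      span : + 3 ∣ - n ⇔ ∃₂ λ p q → m ≡ p × n ≡ q * + 3
      span = mk⇔
        (λ { (divides j e) → m , - j , refl ,
               trans (sym (ℤP.neg-involutive n)) (trans (cong -_ e) (ℤP.neg-distribˡ-* j (+ 3))) })
        (λ { (_ , q , _ , refl) → divides (- q) (ℤP.neg-distribˡ-* q (+ 3)) })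

    lattice-when-3∣c : + 3 ∣ c → ∀ m n → + 3 ∣ m * b - n * c ⇔ ∃₂ λ p q → m ≡ p * + 3 × n ≡ q
    lattice-when-3∣c 3∣c m n =
      span ⇔-∘ 3∣-criterion (λ 3∣b → ¬3∣b×3∣c a b c d F 3∣b 3∣c) (∣m⇒∣-m (∣n⇒∣m*n n 3∣c)) refl
      where
      span : + 3 ∣ m ⇔ ∃₂ λ p q → m ≡ p * + 3 × n ≡ q
      span = mk⇔ (λ { (divides p e) → p , n , e , refl })
                 (λ { (p , _ , refl , _) → divides p refl })

    lattice-when-3∣b+c : + 3 ∣ b + c → ∀ m n → + 3 ∣ m * b - n * c ⇔ ∃₂ λ p q → m ≡ p × n ≡ q * + 3 - p
    lattice-when-3∣b+c 3∣b+c m n =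
      span ⇔-∘ 3∣-criterion 3∤b (∣m⇒∣-m (∣n⇒∣m*n n 3∣b+c)) (regroup m n b c)
      where
      3∤b : ¬ + 3 ∣ b
      3∤b 3∣b = ¬3∣b×3∣c a b c d F 3∣b (∣m+n∣m⇒∣n 3∣b+c 3∣b)
      regroup : ∀ m n b c → m * b - n * c ≡ (m + n) * b + - (n * (b + c))
      regroup = ℤ-Ring.solve-∀
      solve-for-n : ∀ m n → n ≡ (m + n) - m
      solve-for-n = ℤ-Ring.solve-∀
      sum : ∀ p q → p + (q * + 3 - p) ≡ q * + 3
      sum = ℤ-Ring.solve-∀
      span : + 3 ∣ m + n ⇔ ∃₂ λ p q → m ≡ p × n ≡ q * + 3 - p
      span = mk⇔ (λ { (divides j e) → m , j , refl , trans (solve-for-n m n) (cong (_- m) e) })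
                 (λ { (p , q , refl , refl) → divides q (sum p q) })

    lattice-when-3∣b-c : + 3 ∣ b - c → ∀ m n → + 3 ∣ m * b - n * c ⇔ ∃₂ λ p q → m ≡ p × n ≡ q * + 3 + p
    lattice-when-3∣b-c 3∣b-c m n =
      span ⇔-∘ 3∣-criterion 3∤b (∣n⇒∣m*n n 3∣b-c) (regroup m n b c)
      where
      recover : ∀ b c → b - (b - c) ≡ c
      recover = ℤ-Ring.solve-∀
      3∤b : ¬ + 3 ∣ b
      3∤b 3∣b = ¬3∣b×3∣c a b c d F 3∣b (subst (+ 3 ∣_) (recover b c) (∣m∣n⇒∣m-n 3∣b 3∣b-c))
      regroup : ∀ m n b c → m * b - n * c ≡ (m - n) * b + n * (b - c)
      regroup = ℤ-Ring.solve-∀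
      solve-for-n : ∀ m n → n ≡ m - (m - n)
      solve-for-n = ℤ-Ring.solve-∀
      rearrange : ∀ m j → m - j * + 3 ≡ - j * + 3 + m
      rearrange = ℤ-Ring.solve-∀
      difference : ∀ p q → p - (q * + 3 + p) ≡ - q * + 3
      difference = ℤ-Ring.solve-∀
      span : + 3 ∣ m - n ⇔ ∃₂ λ p q → m ≡ p × n ≡ q * + 3 + p
      span = mk⇔
        (λ { (divides j e) → m , - j , refl ,
               trans (solve-for-n m n) (trans (cong (λ z → m - z) e) (rearrange m j)) })
        (λ { (p , q , refl , refl) → divides (- q) (difference p q) })

-- The embedding ι : ℤ → ℚ

ℚ-ring : AlmostCommutativeRing _ _
ℚ-ring = fromCommutativeRing ℚP.+-*-commutativeRing (λ x → dec⇒maybe (0ℚ ℚP.≟ x))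

module _ where
  open import Data.Rational using (_+_; _*_; -_; _-_)

  ≡-by-vanishing : ∀ {p q} k {z} → p ≡ q + k * z → z ≡ 0ℚ → p ≡ q
  ≡-by-vanishing {q = q} k e refl = trans e (trans (cong (λ z → q + z) (ℚP.*-zeroʳ k)) (ℚP.+-identityʳ q))

  fromℚᵘ-homo-+ : ∀ p q → fromℚᵘ (p ℚᵘ.+ q) ≡ fromℚᵘ p + fromℚᵘ q
  fromℚᵘ-homo-+ p q = ℚP.toℚᵘ-injective (ℚᵘP.≃-trans (ℚP.toℚᵘ-fromℚᵘ (p ℚᵘ.+ q))
    (ℚᵘP.≃-sym (ℚᵘP.≃-trans (ℚP.toℚᵘ-homo-+ (fromℚᵘ p) (fromℚᵘ q))
      (ℚᵘP.+-cong (ℚP.toℚᵘ-fromℚᵘ p) (ℚP.toℚᵘ-fromℚᵘ q)))))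

  fromℚᵘ-homo-* : ∀ p q → fromℚᵘ (p ℚᵘ.* q) ≡ fromℚᵘ p * fromℚᵘ q
  fromℚᵘ-homo-* p q = ℚP.toℚᵘ-injective (ℚᵘP.≃-trans (ℚP.toℚᵘ-fromℚᵘ (p ℚᵘ.* q))
    (ℚᵘP.≃-sym (ℚᵘP.≃-trans (ℚP.toℚᵘ-homo-* (fromℚᵘ p) (fromℚᵘ q))
      (ℚᵘP.*-cong (ℚP.toℚᵘ-fromℚᵘ p) (ℚP.toℚᵘ-fromℚᵘ q)))))

  fromℚᵘ-homo‿- : ∀ p → fromℚᵘ (ℚᵘ.- p) ≡ - fromℚᵘ p
  fromℚᵘ-homo‿- p = ℚP.toℚᵘ-injective (ℚᵘP.≃-trans (ℚP.toℚᵘ-fromℚᵘ (ℚᵘ.- p))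
    (ℚᵘP.≃-sym (ℚᵘP.≃-trans (ℚP.toℚᵘ-homo‿- (fromℚᵘ p)) (ℚᵘP.-‿cong (ℚP.toℚᵘ-fromℚᵘ p)))))

  -- ι x is fromℚᵘ (mkℚᵘ x 0) by definition.
  ι≡fromℚᵘ : ∀ x p → mkℚᵘ x 0 ℚᵘ.≃ p → ι x ≡ fromℚᵘ p
  ι≡fromℚᵘ x p = ℚP.fromℚᵘ-cong {mkℚᵘ x 0} {p}

  ι-+ : ∀ x y → ι (x ℤ.+ y) ≡ ι x + ι y
  ι-+ x y = trans (ι≡fromℚᵘ (x ℤ.+ y) (mkℚᵘ x 0 ℚᵘ.+ mkℚᵘ y 0) (*≡* (same x y)))
                  (fromℚᵘ-homo-+ (mkℚᵘ x 0) (mkℚᵘ y 0))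
    where
    same : ∀ x y → (x ℤ.+ y) ℤ.* + 1 ≡ (x ℤ.* + 1 ℤ.+ y ℤ.* + 1) ℤ.* + 1
    same = ℤ-Ring.solve-∀

  ι-* : ∀ x y → ι (x ℤ.* y) ≡ ι x * ι y
  ι-* x y = fromℚᵘ-homo-* (mkℚᵘ x 0) (mkℚᵘ y 0)

  ι-neg : ∀ x → ι (ℤ.- x) ≡ - ι x
  ι-neg x = fromℚᵘ-homo‿- (mkℚᵘ x 0)

  ι-- : ∀ x y → ι (x ℤ.- y) ≡ ι x - ι y
  ι-- x y = trans (ι-+ x (ℤ.- y)) (cong (λ z → ι x + z) (ι-neg y))

  ι-injective : ∀ {x y} → ι x ≡ ι y → x ≡ y
  ι-injective {x} {y} e with ℚP.fromℚᵘ-injective {mkℚᵘ x 0} {mkℚᵘ y 0} e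
  ... | *≡* x*1≡y*1 = trans (sym (ℤP.*-identityʳ x)) (trans x*1≡y*1 (ℤP.*-identityʳ y))

  private
    n*1*1≡n+0+0 : ∀ n → n ℕ.* 1 ℕ.* 1 ≡ n ℕ.+ 0 ℕ.+ 0
    n*1*1≡n+0+0 = ℕ-Ring.solve-∀

  ι-*-invℤ : ∀ a → a ≢ + 0 → ι a * invℤ a ≡ 1ℚ
  ι-*-invℤ (+ 0)     a≢0 = contradiction refl a≢0
  ι-*-invℤ (+ suc n) _   = trans (sym (fromℚᵘ-homo-* (mkℚᵘ (+ suc n) 0) (mkℚᵘ (+ 1) n)))
    (ℚP.fromℚᵘ-cong {mkℚᵘ (+ suc n) 0 ℚᵘ.* mkℚᵘ (+ 1) n} {ℚᵘ.1ℚᵘ}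
      (*≡* (cong (λ k → + suc k) (n*1*1≡n+0+0 n))))
  ι-*-invℤ -[1+ n ]  _   = trans (sym (fromℚᵘ-homo-* (mkℚᵘ -[1+ n ] 0) (mkℚᵘ -[1+ 0 ] n)))
    (ℚP.fromℚᵘ-cong {mkℚᵘ -[1+ n ] 0 ℚᵘ.* mkℚᵘ -[1+ 0 ] n} {ℚᵘ.1ℚᵘ}
      (*≡* (cong (λ k → + suc k) (n*1*1≡n+0+0 n))))

  IrreducibleForm⇒a≢0 : ∀ a b c d → IrreducibleForm a b c d → a ≢ + 0
  IrreducibleForm⇒a≢0 _ b c d irreducible refl = irreducible
    (0ℚ , 1ℚ , ι b , ι c , ι d ,
     sym (ℚP.*-zeroˡ (ι b)) , shift (ι b) (ι c) , shift (ι c) (ι d) , sym (ℚP.*-identityˡ (ι d)))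
    where
    shift : ∀ x y → x ≡ 0ℚ * y + 1ℚ * x
    shift = solve-∀ ℚ-ring

-- The cubic field

⟨⟩-cong : ∀ {x0 x1 x2 y0 y1 y2} → x0 ≡ y0 → x1 ≡ y1 → x2 ≡ y2 → ⟨ x0 , x1 , x2 ⟩ ≡ ⟨ y0 , y1 , y2 ⟩
⟨⟩-cong refl refl refl = refl

module _ (a b c d : ℤ) where
  open Field a b c d
  open import Data.Rational using (_+_; _*_; -_; _-_)
  open Signed using (_∣_)

  trace-in-coordinates : ∀ x → tr x ≡ c0 x + c0 x + c0 x + c1 x * r2 + c2 x * (r1 + r1 + r2 * r2)
  trace-in-coordinates ⟨ x0 , x1 , x2 ⟩ = expand r0 r1 r2 x0 x1 x2
    where
    expand : ∀ r0 r1 r2 x0 x1 x2 →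
      let t0 = 0ℚ * 0ℚ + (1ℚ * 0ℚ + 0ℚ * 1ℚ) * r0 + 0ℚ * 0ℚ * (r2 * r0)
          t1 = 0ℚ * 1ℚ + 1ℚ * 0ℚ + (1ℚ * 0ℚ + 0ℚ * 1ℚ) * r1 + 0ℚ * 0ℚ * (r0 + r2 * r1)
          t2 = 0ℚ * 0ℚ + 1ℚ * 1ℚ + 0ℚ * 0ℚ + (1ℚ * 0ℚ + 0ℚ * 1ℚ) * r2 + 0ℚ * 0ℚ * (r1 + r2 * r2)
      in (x0 * 1ℚ + (x1 * 0ℚ + x2 * 0ℚ) * r0 + x2 * 0ℚ * (r2 * r0))
         + (x0 * 1ℚ + x1 * 0ℚ + (x1 * 0ℚ + x2 * 1ℚ) * r1 + x2 * 0ℚ * (r0 + r2 * r1))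
         + (x0 * t2 + x1 * t1 + x2 * t0 + (x1 * t2 + x2 * t1) * r2 + x2 * t2 * (r1 + r2 * r2))
         ≡ x0 + x0 + x0 + x1 * r2 + x2 * (r1 + r1 + r2 * r2)
    expand = solve-∀ ℚ-ring

  tr-⊕ : ∀ x y → tr (x ⊕ y) ≡ tr x + tr y
  tr-⊕ x@(⟨ x0 , x1 , x2 ⟩) y@(⟨ y0 , y1 , y2 ⟩) = begin
    tr (x ⊕ y)  ≡⟨ trace-in-coordinates (x ⊕ y) ⟩
    _           ≡⟨ additive r1 r2 x0 x1 x2 y0 y1 y2 ⟩
    _           ≡⟨ cong₂ _+_ (trace-in-coordinates x) (trace-in-coordinates y) ⟨
    tr x + tr y ∎
    where
    additive : ∀ r1 r2 x0 x1 x2 y0 y1 y2 →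
      let T = λ z0 z1 z2 → z0 + z0 + z0 + z1 * r2 + z2 * (r1 + r1 + r2 * r2)
      in T (x0 + y0) (x1 + y1) (x2 + y2) ≡ T x0 x1 x2 + T y0 y1 y2
    additive = solve-∀ ℚ-ring

  tr-· : ∀ q x → tr (q · x) ≡ q * tr x
  tr-· q x@(⟨ x0 , x1 , x2 ⟩) = begin
    tr (q · x)  ≡⟨ trace-in-coordinates (q · x) ⟩
    _           ≡⟨ homogeneous r1 r2 q x0 x1 x2 ⟩
    _           ≡⟨ cong (q *_) (trace-in-coordinates x) ⟨
    q * tr x    ∎
    where
    homogeneous : ∀ r1 r2 q x0 x1 x2 →
      let T = λ z0 z1 z2 → z0 + z0 + z0 + z1 * r2 + z2 * (r1 + r1 + r2 * r2)
      in T (q * x0) (q * x1) (q * x2) ≡ q * T x0 x1 x2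
    homogeneous = solve-∀ ℚ-ring

  tr-𝟙 : tr 𝟙 ≡ ι (+ 3)
  tr-𝟙 = trans (trace-in-coordinates 𝟙) (three r1 r2)
    where
    three : ∀ r1 r2 → 1ℚ + 1ℚ + 1ℚ + 0ℚ * r2 + 0ℚ * (r1 + r1 + r2 * r2) ≡ ι (+ 3)
    three = solve-∀ ℚ-ring

  tr-θ : tr θ ≡ r2
  tr-θ = trans (trace-in-coordinates θ) (coefficient r1 r2)
    where
    coefficient : ∀ r1 r2 → 0ℚ + 0ℚ + 0ℚ + 1ℚ * r2 + 0ℚ * (r1 + r1 + r2 * r2) ≡ r2
    coefficient = solve-∀ ℚ-ring

  ·-assoc : ∀ p q x → p · (q · x) ≡ (p * q) · x
  ·-assoc p q ⟨ x0 , x1 , x2 ⟩ =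
    ⟨⟩-cong (sym (ℚP.*-assoc p q x0)) (sym (ℚP.*-assoc p q x1)) (sym (ℚP.*-assoc p q x2))

  ⊖-collect : ∀ p q u v → p · (u ⊖ v) ⊕ q · v ≡ p · u ⊕ (q - p) · v
  ⊖-collect p q ⟨ u0 , u1 , u2 ⟩ ⟨ v0 , v1 , v2 ⟩ =
    ⟨⟩-cong (collect p q u0 v0) (collect p q u1 v1) (collect p q u2 v2)
    where
    collect : ∀ p q u v → p * (u + - 1ℚ * v) + q * v ≡ p * u + (q - p) * v
    collect = solve-∀ ℚ-ring

  ⊕-collect : ∀ p q u v → p · (u ⊕ v) ⊕ q · v ≡ p · u ⊕ (q + p) · v
  ⊕-collect p q ⟨ u0 , u1 , u2 ⟩ ⟨ v0 , v1 , v2 ⟩ =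
    ⟨⟩-cong (collect p q u0 v0) (collect p q u1 v1) (collect p q u2 v2)
    where
    collect : ∀ p q u v → p * (u + v) + q * v ≡ p * u + (q + p) * v
    collect = solve-∀ ℚ-ring

  ofBasis : ℤ → ℤ → ℤ → K
  ofBasis l m n = ι l · 𝟙 ⊕ ι m · α ⊕ ι n · β

  ofBasis₀ : ℤ → ℤ → K
  ofBasis₀ m n = ι m · α₀ ⊕ ι n · β₀

  tr-ofBasis-linear : ∀ l m n → tr (ofBasis l m n) ≡ ι l * ι (+ 3) + ι m * tr α + ι n * tr β
  tr-ofBasis-linear l m n = begin
    tr (ofBasis l m n)
      ≡⟨ tr-⊕ (ι l · 𝟙 ⊕ ι m · α) (ι n · β) ⟩
    tr (ι l · 𝟙 ⊕ ι m · α) + tr (ι n · β)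
      ≡⟨ cong₂ _+_ (tr-⊕ (ι l · 𝟙) (ι m · α)) (tr-· (ι n) β) ⟩
    tr (ι l · 𝟙) + tr (ι m · α) + ι n * tr β
      ≡⟨ cong₂ (λ u v → u + v + ι n * tr β) (trans (tr-· (ι l) 𝟙) (cong (ι l *_) tr-𝟙)) (tr-· (ι m) α) ⟩
    ι l * ι (+ 3) + ι m * tr α + ι n * tr β ∎

  -- As tr 𝟙 = 3, the corrections - tr α / 3 and - tr β / 3 in α₀ and β₀ add up to the
  -- 𝟙-coordinate of a trace-zero element.
  ofBasis≡ofBasis₀ : ∀ l m n → tr (ofBasis l m n) ≡ 0ℚ → ofBasis l m n ≡ ofBasis₀ m n
  ofBasis≡ofBasis₀ l m n tr≡0 =
    shift (ι l) (ι m) (ι n) (tr α) (tr β) α β (trans (sym (tr-ofBasis-linear l m n)) tr≡0)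
    where
    shift : ∀ r p q s t u v → r * ι (+ 3) + p * s + q * t ≡ 0ℚ →
      r · 𝟙 ⊕ p · u ⊕ q · v ≡ p · (u ⊖ [ s * third ]) ⊕ q · (v ⊖ [ t * third ])
    shift r p q s t ⟨ u0 , u1 , u2 ⟩ ⟨ v0 , v1 , v2 ⟩ z≡0 =
      ⟨⟩-cong (≡-by-vanishing third (constant r p q s t u0 v0) z≡0)
              (other r p q u1 v1) (other r p q u2 v2)
      where
      constant : ∀ r p q s t u0 v0 →
        r * 1ℚ + p * u0 + q * v0
          ≡ p * (u0 + - 1ℚ * (s * third)) + q * (v0 + - 1ℚ * (t * third))
            + third * (r * ι (+ 3) + p * s + q * t)
      constant = solve-∀ ℚ-ring
      other : ∀ r p q u1 v1 → r * 0ℚ + p * u1 + q * v1 ≡ p * (u1 + - 1ℚ * 0ℚ) + q * (v1 + - 1ℚ * 0ℚ)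
      other = solve-∀ ℚ-ring

  combination-α₀-3β₀ : ∀ p q → ι p · α₀ ⊕ ι q · (ι (+ 3) · β₀) ≡ ofBasis₀ p (q ℤ.* + 3)
  combination-α₀-3β₀ p q =
    cong (λ v → ι p · α₀ ⊕ v) (trans (·-assoc (ι q) (ι (+ 3)) β₀) (cong (_· β₀) (sym (ι-* q (+ 3)))))

  combination-3α₀-β₀ : ∀ p q → ι p · (ι (+ 3) · α₀) ⊕ ι q · β₀ ≡ ofBasis₀ (p ℤ.* + 3) q
  combination-3α₀-β₀ p q =
    cong (λ u → u ⊕ ι q · β₀) (trans (·-assoc (ι p) (ι (+ 3)) α₀) (cong (_· α₀) (sym (ι-* p (+ 3)))))

  combination-α₀⊖β₀-3β₀ : ∀ p q →
    ι p · (α₀ ⊖ β₀) ⊕ ι q · (ι (+ 3) · β₀) ≡ ofBasis₀ p (q ℤ.* + 3 ℤ.- p)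
  combination-α₀⊖β₀-3β₀ p q = begin
    ι p · (α₀ ⊖ β₀) ⊕ ι q · (ι (+ 3) · β₀)
      ≡⟨ cong (λ v → ι p · (α₀ ⊖ β₀) ⊕ v) (·-assoc (ι q) (ι (+ 3)) β₀) ⟩
    ι p · (α₀ ⊖ β₀) ⊕ (ι q * ι (+ 3)) · β₀
      ≡⟨ ⊖-collect (ι p) (ι q * ι (+ 3)) α₀ β₀ ⟩
    ι p · α₀ ⊕ (ι q * ι (+ 3) - ι p) · β₀
      ≡⟨ cong (λ s → ι p · α₀ ⊕ s · β₀) coefficient ⟩
    ofBasis₀ p (q ℤ.* + 3 ℤ.- p)
      ∎
    where
    coefficient : ι q * ι (+ 3) - ι p ≡ ι (q ℤ.* + 3 ℤ.- p)
    coefficient = trans (cong (_- ι p) (sym (ι-* q (+ 3)))) (sym (ι-- (q ℤ.* + 3) p))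

  combination-α₀⊕β₀-3β₀ : ∀ p q →
    ι p · (α₀ ⊕ β₀) ⊕ ι q · (ι (+ 3) · β₀) ≡ ofBasis₀ p (q ℤ.* + 3 ℤ.+ p)
  combination-α₀⊕β₀-3β₀ p q = begin
    ι p · (α₀ ⊕ β₀) ⊕ ι q · (ι (+ 3) · β₀)
      ≡⟨ cong (λ v → ι p · (α₀ ⊕ β₀) ⊕ v) (·-assoc (ι q) (ι (+ 3)) β₀) ⟩
    ι p · (α₀ ⊕ β₀) ⊕ (ι q * ι (+ 3)) · β₀
      ≡⟨ ⊕-collect (ι p) (ι q * ι (+ 3)) α₀ β₀ ⟩
    ι p · α₀ ⊕ (ι q * ι (+ 3) + ι p) · β₀
      ≡⟨ cong (λ s → ι p · α₀ ⊕ s · β₀) coefficient ⟩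
    ofBasis₀ p (q ℤ.* + 3 ℤ.+ p)
      ∎
    where
    coefficient : ι q * ι (+ 3) + ι p ≡ ι (q ℤ.* + 3 ℤ.+ p)
    coefficient = trans (cong (_+ ι p) (sym (ι-* q (+ 3)))) (sym (ι-+ (q ℤ.* + 3) p))

  module _ (a≢0 : a ≢ + 0) where

    a*a⁻¹-1≡0 : ι a * invℤ a - 1ℚ ≡ 0ℚ
    a*a⁻¹-1≡0 = cong (_- 1ℚ) (ι-*-invℤ a a≢0)

    tr-α : tr α ≡ ι b
    tr-α = begin
      tr α                      ≡⟨ tr-· (ι (ℤ.- a)) θ ⟩
      ι (ℤ.- a) * tr θ          ≡⟨ cong₂ _*_ (ι-neg a) tr-θ ⟩
      - ι a * - (ι b * invℤ a)  ≡⟨ ≡-by-vanishing (ι b) (expand (ι a) (ι b) (invℤ a)) a*a⁻¹-1≡0 ⟩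
      ι b                       ∎
      where
      expand : ∀ A B I → - A * - (B * I) ≡ B + B * (A * I - 1ℚ)
      expand = solve-∀ ℚ-ring

    tr-β : tr β ≡ - ι c
    tr-β = begin
      tr β                          ≡⟨ cong tr (⟨⟩-cong (ι-neg c) (ι-neg b) (ι-neg a)) ⟩
      tr ⟨ - ι c , - ι b , - ι a ⟩  ≡⟨ trace-in-coordinates ⟨ - ι c , - ι b , - ι a ⟩ ⟩
      _                             ≡⟨ ≡-by-vanishing (ι c + ι c - ι b * ι b * invℤ a)
                                         (expand (ι a) (ι b) (ι c) (invℤ a)) a*a⁻¹-1≡0 ⟩
      - ι c                         ∎
      where
      expand : ∀ A B C I →
        let r1 = - (C * I); r2 = - (B * I)
        in - C + - C + - C + - B * r2 + - A * (r1 + r1 + r2 * r2)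
           ≡ - C + (C + C - B * B * I) * (A * I - 1ℚ)
      expand = solve-∀ ℚ-ring

    tr-ofBasis : ∀ l m n → tr (ofBasis l m n) ≡ ι (l ℤ.* + 3 ℤ.+ (m ℤ.* b ℤ.- n ℤ.* c))
    tr-ofBasis l m n = begin
      tr (ofBasis l m n)
        ≡⟨ tr-ofBasis-linear l m n ⟩
      ι l * ι (+ 3) + ι m * tr α + ι n * tr β
        ≡⟨ cong₂ (λ u v → ι l * ι (+ 3) + ι m * u + ι n * v) tr-α tr-β ⟩
      ι l * ι (+ 3) + ι m * ι b + ι n * - ι c
        ≡⟨ regroup (ι l * ι (+ 3)) (ι m * ι b) (ι n) (ι c) ⟩
      ι l * ι (+ 3) + (ι m * ι b - ι n * ι c)
        ≡⟨ cong₂ _+_ (ι-* l (+ 3)) (cong₂ _-_ (ι-* m b) (ι-* n c)) ⟨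
      ι (l ℤ.* + 3) + (ι (m ℤ.* b) - ι (n ℤ.* c))
        ≡⟨ trans (ι-+ (l ℤ.* + 3) _) (cong (λ z → ι (l ℤ.* + 3) + z) (ι-- (m ℤ.* b) _)) ⟨
      ι (l ℤ.* + 3 ℤ.+ (m ℤ.* b ℤ.- n ℤ.* c))
        ∎
      where
      regroup : ∀ x y n c → x + y + n * - c ≡ x + (y - n * c)
      regroup = solve-∀ ℚ-ring

    module _ (DF : DeloneFaddeevBasis) where

      InOK0⇔ofBasis₀ : ∀ x → InOK0 x ⇔ ∃₂ λ m n → + 3 ∣ m ℤ.* b ℤ.- n ℤ.* c × x ≡ ofBasis₀ m n
      InOK0⇔ofBasis₀ x = mk⇔ to from
        where
        trace-vanishes : ∀ l m n → l ℤ.* + 3 ℤ.+ (m ℤ.* b ℤ.- n ℤ.* c) ≡ + 0 → tr (ofBasis l m n) ≡ 0ℚ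
        trace-vanishes l m n e = trans (tr-ofBasis l m n) (cong ι e)
        to : InOK0 x → ∃₂ λ m n → + 3 ∣ m ℤ.* b ℤ.- n ℤ.* c × x ≡ ofBasis₀ m n
        to (x-integral , tr-x≡0) with proj₁ (DF x) x-integral
        ... | l , m , n , x≡ = m , n , Equivalence.from (3∣⇔cancellable _) (l , integral) ,
                               trans x≡ (ofBasis≡ofBasis₀ l m n tr≡0)
          where
          tr≡0 : tr (ofBasis l m n) ≡ 0ℚ
          tr≡0 = trans (cong tr (sym x≡)) tr-x≡0
          integral : l ℤ.* + 3 ℤ.+ (m ℤ.* b ℤ.- n ℤ.* c) ≡ + 0
          integral = ι-injective (trans (sym (tr-ofBasis l m n)) tr≡0)
        from : (∃₂ λ m n → + 3 ∣ m ℤ.* b ℤ.- n ℤ.* c × x ≡ ofBasis₀ m n) → InOK0 x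
        from (m , n , 3∣ , x≡) with Equivalence.to (3∣⇔cancellable _) 3∣
        ... | l , e = proj₂ (DF x) (l , m , n , x≡ofBasis) , trans (cong tr x≡ofBasis) (trace-vanishes l m n e)
          where
          x≡ofBasis : x ≡ ofBasis l m n
          x≡ofBasis = trans x≡ (sym (ofBasis≡ofBasis₀ l m n (trace-vanishes l m n e)))

      InOK0⇔SpanZ : ∀ (U V : K) (f g : ℤ → ℤ → ℤ) →
        (∀ p q → ι p · U ⊕ ι q · V ≡ ofBasis₀ (f p q) (g p q)) →
        (∀ m n → + 3 ∣ m ℤ.* b ℤ.- n ℤ.* c ⇔ ∃₂ λ p q → m ≡ f p q × n ≡ g p q) →
        ∀ x → InOK0 x ⇔ SpanZ U V x
      InOK0⇔SpanZ U V f g combination lattice x = mk⇔ to from ⇔-∘ InOK0⇔ofBasis₀ x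
        where
        to : (∃₂ λ m n → + 3 ∣ m ℤ.* b ℤ.- n ℤ.* c × x ≡ ofBasis₀ m n) → SpanZ U V x
        to (m , n , 3∣ , x≡) with Equivalence.to (lattice m n) 3∣
        ... | p , q , refl , refl = p , q , trans x≡ (sym (combination p q))
        from : SpanZ U V x → ∃₂ λ m n → + 3 ∣ m ℤ.* b ℤ.- n ℤ.* c × x ≡ ofBasis₀ m n
        from (p , q , x≡) = f p q , g p q , Equivalence.from (lattice _ _) (p , q , refl , refl) ,
                            trans x≡ (combination p q)

      InOK0⇔SpanZ-3∣b : IsFundamental (disc a b c d) → + 3 ∣ b →
        ∀ x → InOK0 x ⇔ SpanZ α₀ (ι (+ 3) · β₀) x
      InOK0⇔SpanZ-3∣b F 3∣b =
        InOK0⇔SpanZ α₀ (ι (+ 3) · β₀) _ _ combination-α₀-3β₀ (lattice-when-3∣b a b c d F 3∣b)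

      InOK0⇔SpanZ-3∣c : IsFundamental (disc a b c d) → + 3 ∣ c →
        ∀ x → InOK0 x ⇔ SpanZ (ι (+ 3) · α₀) β₀ x
      InOK0⇔SpanZ-3∣c F 3∣c =
        InOK0⇔SpanZ (ι (+ 3) · α₀) β₀ _ _ combination-3α₀-β₀ (lattice-when-3∣c a b c d F 3∣c)

      InOK0⇔SpanZ-3∣b+c : IsFundamental (disc a b c d) → + 3 ∣ b ℤ.+ c →
        ∀ x → InOK0 x ⇔ SpanZ (α₀ ⊖ β₀) (ι (+ 3) · β₀) x
      InOK0⇔SpanZ-3∣b+c F 3∣b+c =
        InOK0⇔SpanZ (α₀ ⊖ β₀) (ι (+ 3) · β₀) _ _ combination-α₀⊖β₀-3β₀
                    (lattice-when-3∣b+c a b c d F 3∣b+c)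

      InOK0⇔SpanZ-3∣b-c : IsFundamental (disc a b c d) → + 3 ∣ b ℤ.- c →
        ∀ x → InOK0 x ⇔ SpanZ (α₀ ⊕ β₀) (ι (+ 3) · β₀) x
      InOK0⇔SpanZ-3∣b-c F 3∣b-c =
        InOK0⇔SpanZ (α₀ ⊕ β₀) (ι (+ 3) · β₀) _ _ combination-α₀⊕β₀-3β₀
                    (lattice-when-3∣b-c a b c d F 3∣b-c)

open import Data.Integer using (_+_; _-_)
open import Data.Integer.Divisibility using (_∣_)

proposition5p2 :
    (a b c d : ℤ) →
    IrreducibleForm a b c d →
    IsFundamental (disc a b c d) →
    Field.DeloneFaddeevBasis a b c d →
    let open Field a b c d in
      ((+ 3) ∣ b → ∀ (x : K) → InOK0 x ⇔ SpanZ α₀ (ι (+ 3) · β₀) x)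
    × ((+ 3) ∣ c → ∀ (x : K) → InOK0 x ⇔ SpanZ (ι (+ 3) · α₀) β₀ x)
    × ((+ 3) ∣ (b + c) → ∀ (x : K) → InOK0 x ⇔ SpanZ (α₀ ⊖ β₀) (ι (+ 3) · β₀) x)
    × ((+ 3) ∣ (b - c) → ∀ (x : K) → InOK0 x ⇔ SpanZ (α₀ ⊕ β₀) (ι (+ 3) · β₀) x)
proposition5p2 a b c d irreducible F DF =
    (λ 3∣b → InOK0⇔SpanZ-3∣b a b c d a≢0 DF F (∣ᵤ⇒∣ 3∣b))
  , (λ 3∣c → InOK0⇔SpanZ-3∣c a b c d a≢0 DF F (∣ᵤ⇒∣ 3∣c))
  , (λ 3∣b+c → InOK0⇔SpanZ-3∣b+c a b c d a≢0 DF F (∣ᵤ⇒∣ 3∣b+c))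
  , (λ 3∣b-c → InOK0⇔SpanZ-3∣b-c a b c d a≢0 DF F (∣ᵤ⇒∣ 3∣b-c))
  where
  open Signed using (∣ᵤ⇒∣)
  a≢0 : a ≢ + 0
  a≢0 = IrreducibleForm⇒a≢0 a b c d irreducible
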